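{- If $G$ and $H$ are non-trivial connected graphs and $\gamma(G)=\gamma_t(G)$, then $\gamma_{r2}(G\circ H)=2\gamma(G)$.
   Context: All graphs are finite and simple; non-trivial means at least two vertices. A $2$-rainbow dominating function of a graph $X$ is a map $f\colon V(X)\to 2^{\{1,2\}}$ such that for every vertex $v$ with $f(v)=\emptyset$ we have $\bigcup_{u\in N(v)} f(u)=\{1,2\}$; its weight is $\sum_v |f(v)|$, and $\gamma_{r2}(X)$ is the minimum weight of such a function. The lexicographic product $G\circ H$ has vertex set $V(G)\times V(H)$, with $(g_1,h_1)$ adjacent to $(g_2,h_2)$ iff $g_1g_2\in E(G)$, or $g_1=g_2$ and $h_1h_2\in E(H)$. $\gamma(G)$ is the domination number and $\gamma_t(G)$ the total domination number of $G$ (minimum size of a set $S$ such that every vertex of $G$ has a neighbor in $S$). -}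

module Defs where

open import Data.Nat using (ℕ; zero; suc; _+_; _*_; _≤_; _<_)
open import Data.Fin using (Fin)
open import Data.Bool using (Bool; true; false; T; _∨_; not)
open import Data.Product using (_×_; _,_; Σ; ∃; ∃-syntax; proj₁; proj₂)
open import Data.Sum using (_⊎_)
open import Data.Empty using (⊥)
open import Data.Vec.Functional using (Vector; foldr)
open import Relation.Binary.PropositionalEquality using (_≡_)
open import Relation.Nullary using (¬_)

record Graph : Set where
  field
    n     : ℕ
    adj   : Fin n → Fin n → Bool
    sym   : ∀ u v → adj u v ≡ adj v u
    irrefl : ∀ v → adj v v ≡ false
open Graph public

Adj : (G : Graph) → Fin (n G) → Fin (n G) → Set
Adj G u v = T (adj G u v)

NonTrivial : Graph → Set
NonTrivial G = 2 ≤ n G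

data Walk (G : Graph) : Fin (n G) → Fin (n G) → Set where
  here : ∀ {v} → Walk G v v
  step : ∀ {u v w} → Adj G u v → Walk G v w → Walk G u w

Connected : Graph → Set
Connected G = ∀ u v → Walk G u v

Σv : ∀ {m} → (Fin m → ℕ) → ℕ
Σv {m} f = foldr _+_ 0 f

b2n : Bool → ℕ
b2n true = 1
b2n false = 0

VSet : Graph → Set
VSet G = Fin (n G) → Bool

size : (G : Graph) → VSet G → ℕ
size G S = Σv (λ v → b2n (S v))

Dominating : (G : Graph) → VSet G → Set
Dominating G S = ∀ v → T (S v) ⊎ (∃[ u ] (Adj G v u × T (S u)))

TotalDominating : (G : Graph) → VSet G → Set
TotalDominating G S = ∀ v → ∃[ u ] (Adj G v u × T (S u))

IsMinSize : (G : Graph) → (VSet G → Set) → ℕ → Set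
IsMinSize G P k = (∃[ S ] (P S × size G S ≡ k)) × (∀ S → P S → k ≤ size G S)

IsDominationNumber : Graph → ℕ → Set
IsDominationNumber G k = IsMinSize G (Dominating G) k

IsTotalDominationNumber : Graph → ℕ → Set
IsTotalDominationNumber G k = IsMinSize G (TotalDominating G) k

open import Data.Bool using (_∧_)
open import Data.Fin using (_≟_)
open import Relation.Nullary using (does)

LexV : Graph → Graph → Set
LexV G H = Fin (n G) × Fin (n H)

LexAdj : (G H : Graph) → LexV G H → LexV G H → Set
LexAdj G H (g₁ , h₁) (g₂ , h₂) = Adj G g₁ g₂ ⊎ (g₁ ≡ g₂ × Adj H h₁ h₂)

ΣLex : (G H : Graph) → (LexV G H → ℕ) → ℕ
ΣLex G H f = Σv (λ g → Σv (λ h → f (g , h)))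

-- A label f(v) ⊆ {1,2} is encoded as a pair of Booleans (1 ∈ f(v) , 2 ∈ f(v)).
Label : Set
Label = Bool × Bool

card : Label → ℕ
card (a , b) = b2n a + b2n b

IsEmpty : Label → Set
IsEmpty (a , b) = a ≡ false × b ≡ false

IsR2DF : (G H : Graph) → (LexV G H → Label) → Set
IsR2DF G H f = ∀ v → IsEmpty (f v) →
  (∃[ u ] (LexAdj G H v u × T (proj₁ (f u)))) ×
  (∃[ u ] (LexAdj G H v u × T (proj₂ (f u))))

weight : (G H : Graph) → (LexV G H → Label) → ℕ
weight G H f = ΣLex G H (λ v → card (f v))

IsLexR2Number : Graph → Graph → ℕ → Set
IsLexR2Number G H k =
  (∃[ f ] (IsR2DF G H f × weight G H f ≡ k)) ×
  (∀ f → IsR2DF G H f → k ≤ weight G H f)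

-- Upper bound: if S is a total dominating set of G and h₀ a vertex of H, putting both
-- colours on (g , h₀) for g ∈ S is a 2-rainbow dominating function of G ∘ H, because
-- every (g , h) has a G-neighbour g′ ∈ S and (g′ , h₀) is adjacent to (g , h).
-- Lower bound: given a 2-rainbow dominating function f, let Dᵢ consist of the g whose
-- fibre {g} × V(H) carries colour i or has weight at least 2. Each Dᵢ dominates G: a fibre
-- outside Dᵢ has weight at most 1, so (H being non-trivial) it contains an unlabelled
-- vertex, whose neighbour coloured i lies in another fibre, i.e. in a G-neighbour in Dᵢ.
-- Each fibre contributes at most its weight to |D₁| + |D₂|, whence 2 γ(G) ≤ weight f.
module Submission where

open import Defs hiding (sym)
open import Data.Nat using (ℕ; zero; suc; _+_; _*_; _≤_; _≤ᵇ_; z≤n; s≤s; s≤s⁻¹)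
open import Data.Nat.Properties
  using (+-0-commutativeMonoid; +-mono-≤; +-identityʳ; m≤m+n; m+n≤o⇒n≤o; ≮⇒≥; ≤⇒≤ᵇ;
         ≤-refl; ≤-trans; module ≤-Reasoning)
open import Data.Fin using (Fin; zero; suc; fromℕ<; _≟_; punchIn)
open import Data.Fin.Properties using (punchInᵢ≢i)
open import Data.Bool using (Bool; true; false; T; T?; _∨_; if_then_else_)
open import Data.Bool.Properties using (T-∨; if-float)
open import Data.Product using (_×_; _,_; ∃-syntax; proj₁; proj₂)
open import Data.Sum using (inj₁; inj₂)
open import Data.Empty using (⊥-elim)
open import Function using (_∘_)
open import Function.Bundles using (Equivalence)
open import Relation.Nullary using (¬_; yes; no; does)
open import Relation.Nullary.Decidable using (dec-true; dec-false)
open import Relation.Binary.PropositionalEquality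
  using (_≡_; refl; sym; trans; cong; cong₂; subst; module ≡-Reasoning)
open import Algebra.Properties.CommutativeMonoid.Sum +-0-commutativeMonoid
  using (sum-cong-≗; ∑-distrib-+; sum-remove; sum-replicate-zero)

Σv-mono-≤ : ∀ {m} {f g : Fin m → ℕ} → (∀ i → f i ≤ g i) → Σv f ≤ Σv g
Σv-mono-≤ {zero}  f≤g = z≤n
Σv-mono-≤ {suc m} f≤g = +-mono-≤ (f≤g zero) (Σv-mono-≤ (f≤g ∘ suc))

term≤Σv : ∀ {m} (f : Fin m → ℕ) i → f i ≤ Σv f
term≤Σv {suc m} f i = subst (f i ≤_) (sym (sum-remove f)) (m≤m+n _ _)

Σv≤1⇒zero : ∀ {m} → 2 ≤ m → (f : Fin m → ℕ) → Σv f ≤ 1 → ∃[ i ] f i ≡ 0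
Σv≤1⇒zero {suc (suc m)} (s≤s (s≤s z≤n)) f Σf≤1 with f zero in f₀ | f (suc zero) in f₁
... | zero  | _     = zero , f₀
... | suc _ | zero  = suc zero , f₁
... | suc a | suc _ with () ← m+n≤o⇒n≤o a (s≤s⁻¹ Σf≤1)

Σv-pointMass : ∀ {m} (i : Fin m) (x : ℕ) → Σv (λ j → if does (j ≟ i) then x else 0) ≡ x
Σv-pointMass {suc m} i x = begin
  Σv t                      ≡⟨ sum-remove {i = i} t ⟩
  t i + Σv (t ∘ punchIn i)  ≡⟨ cong₂ _+_ (cong (if_then x else 0) (dec-true (i ≟ i) refl))
                                       (trans (sum-cong-≗ off-i) (sum-replicate-zero m)) ⟩
  x + 0                     ≡⟨ +-identityʳ x ⟩
  x                         ∎
  where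
  open ≡-Reasoning
  t : Fin (suc m) → ℕ
  t j = if does (j ≟ i) then x else 0
  off-i : ∀ j → t (punchIn i j) ≡ 0
  off-i j = cong (if_then x else 0) (dec-false (punchIn i j ≟ i) (punchInᵢ≢i i j))

card≡0⇒IsEmpty : ∀ l → card l ≡ 0 → IsEmpty l
card≡0⇒IsEmpty (false , false) _ = refl , refl

card≡b2n+b2n : ∀ l → card l ≡ b2n (proj₁ l) + b2n (proj₂ l)
card≡b2n+b2n (a , b) = refl

T⇒1≤b2n : ∀ {b} → T b → 1 ≤ b2n b
T⇒1≤b2n {true} _ = ≤-refl

-- Unless a fibre carries both colours, being in both shadows forces its weight a + b ≥ 2.
shadows≤weight : ∀ a b {w} → a + b ≡ w → b2n ((1 ≤ᵇ a) ∨ (2 ≤ᵇ w)) + b2n ((1 ≤ᵇ b) ∨ (2 ≤ᵇ w)) ≤ w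
shadows≤weight zero          zero          refl = z≤n
shadows≤weight zero          (suc zero)    refl = ≤-refl
shadows≤weight zero          (suc (suc b)) refl = s≤s (s≤s z≤n)
shadows≤weight (suc zero)    zero          refl = ≤-refl
shadows≤weight (suc (suc a)) zero          refl = s≤s (s≤s z≤n)
shadows≤weight (suc zero)    (suc b)       refl = s≤s (s≤s z≤n)
shadows≤weight (suc (suc a)) (suc b)       refl = s≤s (s≤s z≤n)

module _ (G H : Graph) where

  doubledOn : VSet G → Fin (n H) → LexV G H → Label
  doubledOn S h₀ (g , h) = if does (h ≟ h₀) then (S g , S g) else (false , false)

  doubledOn-at : ∀ S h₀ g → doubledOn S h₀ (g , h₀) ≡ (S g , S g)
  doubledOn-at S h₀ g = cong (if_then (S g , S g) else (false , false)) (dec-true (h₀ ≟ h₀) refl)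

  doubledOn-isR2DF : ∀ {S} → TotalDominating G S → ∀ h₀ → IsR2DF G H (doubledOn S h₀)
  doubledOn-isR2DF {S} S-total h₀ (g , _) _ with S-total g
  ... | g′ , g~g′ , g′∈S = ((g′ , h₀) , inj₁ g~g′ , proj₁ bothColours)
                         , ((g′ , h₀) , inj₁ g~g′ , proj₂ bothColours)
    where
    bothColours : T (proj₁ (doubledOn S h₀ (g′ , h₀))) × T (proj₂ (doubledOn S h₀ (g′ , h₀)))
    bothColours = subst (λ l → T (proj₁ l) × T (proj₂ l)) (sym (doubledOn-at S h₀ g′)) (g′∈S , g′∈S)

  doubledOn-weight : ∀ S h₀ → weight G H (doubledOn S h₀) ≡ 2 * size G S
  doubledOn-weight S h₀ = begin
    Σv (λ g → Σv (λ h → card (doubledOn S h₀ (g , h))))  ≡⟨ sum-cong-≗ fibreWeight ⟩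
    Σv (λ g → b2n (S g) + b2n (S g))                      ≡⟨ ∑-distrib-+ (b2n ∘ S) (b2n ∘ S) ⟩
    size G S + size G S                                   ≡⟨ cong (size G S +_) (sym (+-identityʳ _)) ⟩
    2 * size G S                                          ∎
    where
    open ≡-Reasoning
    fibreWeight : ∀ g → Σv (λ h → card (doubledOn S h₀ (g , h))) ≡ b2n (S g) + b2n (S g)
    fibreWeight g = trans (sum-cong-≗ (λ h → if-float card (does (h ≟ h₀))))
                          (Σv-pointMass h₀ (card (S g , S g)))

  module _ (f : LexV G H → Label) where

    colourCount : (Label → Bool) → Fin (n G) → ℕ
    colourCount c g = Σv (λ h → b2n (c (f (g , h))))

    fibreWeight : Fin (n G) → ℕ
    fibreWeight g = Σv (λ h → card (f (g , h)))

    colourCounts≡fibreWeight : ∀ g → colourCount proj₁ g + colourCount proj₂ g ≡ fibreWeight g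
    colourCounts≡fibreWeight g = sym (trans (sum-cong-≗ (λ h → card≡b2n+b2n (f (g , h))))
      (∑-distrib-+ (λ h → b2n (proj₁ (f (g , h)))) (λ h → b2n (proj₂ (f (g , h))))))

    shadow : (Label → Bool) → VSet G
    shadow c g = (1 ≤ᵇ colourCount c g) ∨ (2 ≤ᵇ fibreWeight g)

    colour⇒shadow : ∀ c {g h} → T (c (f (g , h))) → T (shadow c g)
    colour⇒shadow c {g} {h} t = Equivalence.from T-∨
      (inj₁ (≤⇒≤ᵇ (≤-trans (T⇒1≤b2n t) (term≤Σv (λ h → b2n (c (f (g , h)))) h))))

    ∉shadow⇒light : ∀ c g → ¬ T (shadow c g) → fibreWeight g ≤ 1
    ∉shadow⇒light c g g∉D = ≮⇒≥ (λ 2≤w → g∉D (Equivalence.from T-∨ (inj₂ (≤⇒≤ᵇ 2≤w))))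

    light⇒emptyVertex : NonTrivial H → ∀ g → fibreWeight g ≤ 1 → ∃[ h ] IsEmpty (f (g , h))
    light⇒emptyVertex H-nontrivial g light with Σv≤1⇒zero H-nontrivial (λ h → card (f (g , h))) light
    ... | h , unlabelled = h , card≡0⇒IsEmpty (f (g , h)) unlabelled

    shadow-dominating : NonTrivial H → ∀ c →
      (∀ v → IsEmpty (f v) → ∃[ u ] (LexAdj G H v u × T (c (f u)))) →
      Dominating G (shadow c)
    shadow-dominating H-nontrivial c rainbow g with T? (shadow c g)
    ... | yes g∈D = inj₁ g∈D
    ... | no g∉D with light⇒emptyVertex H-nontrivial g (∉shadow⇒light c g g∉D)
    ... | h , h-empty with rainbow (g , h) h-empty
    ... | (g′ , _) , inj₁ g~g′ , t = inj₂ (g′ , g~g′ , colour⇒shadow c t)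
    ... | (_ , _) , inj₂ (refl , _) , t = ⊥-elim (g∉D (colour⇒shadow c t))

    shadows-size≤weight : size G (shadow proj₁) + size G (shadow proj₂) ≤ weight G H f
    shadows-size≤weight = begin
      size G (shadow proj₁) + size G (shadow proj₂)
        ≡⟨ sym (∑-distrib-+ (b2n ∘ shadow proj₁) (b2n ∘ shadow proj₂)) ⟩
      Σv (λ g → b2n (shadow proj₁ g) + b2n (shadow proj₂ g))
        ≤⟨ Σv-mono-≤ (λ g → shadows≤weight (colourCount proj₁ g) (colourCount proj₂ g)
                                            (colourCounts≡fibreWeight g)) ⟩
      weight G H f
        ∎
      where open ≤-Reasoning

    twiceDomination≤weight : NonTrivial H → IsR2DF G H f →
      ∀ {k} → (∀ S → Dominating G S → k ≤ size G S) → 2 * k ≤ weight G H f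
    twiceDomination≤weight H-nontrivial f-r2df {k} γ≤ = begin
      2 * k                                          ≡⟨ cong (k +_) (+-identityʳ k) ⟩
      k + k                                          ≤⟨ +-mono-≤ (γ≤ _ colour₁-dominating)
                                                                 (γ≤ _ colour₂-dominating) ⟩
      size G (shadow proj₁) + size G (shadow proj₂)  ≤⟨ shadows-size≤weight ⟩
      weight G H f                                   ∎
      where
      open ≤-Reasoning
      colour₁-dominating : Dominating G (shadow proj₁)
      colour₁-dominating = shadow-dominating H-nontrivial proj₁ (λ v ∅ → proj₁ (f-r2df v ∅))
      colour₂-dominating : Dominating G (shadow proj₂)
      colour₂-dominating = shadow-dominating H-nontrivial proj₂ (λ v ∅ → proj₂ (f-r2df v ∅))

corollary9 : (G H : Graph) → NonTrivial G → NonTrivial H → Connected G → Connected H →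
    (k : ℕ) → IsDominationNumber G k → IsTotalDominationNumber G k →
    IsLexR2Number G H (2 * k)
corollary9 G H _ H-nontrivial _ _ k (_ , γ≤) ((S , S-total , |S|≡k) , _) =
  ( doubledOn G H S h₀
  , doubledOn-isR2DF G H S-total h₀
  , trans (doubledOn-weight G H S h₀) (cong (2 *_) |S|≡k) )
  , λ f f-r2df → twiceDomination≤weight G H f H-nontrivial f-r2df γ≤
  where
  h₀ : Fin (n H)
  h₀ = fromℕ< H-nontrivial
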